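{- Let $p$ be an odd prime. For $n\in\mathbb{N}_{\geq 2}$, $1\leq s\leq p-1$ and $sp^{n-2}\leq t\leq p^{n-1}-1$, we have \begin{equation*} \frac{(sp^{n-2})!}{t!}S_{\leq p-1}(t,sp^{n-2})\equiv \begin{cases}0 \pmod p, & \text{ if }p^{n-2}\nmid t, \\ \frac{s!}{(t/p^{n-2})!}S(t/p^{n-2},s) \pmod p, & \text{ if } p^{n-2}\mid t \text{,}\end{cases} \end{equation*} where the congruences are in the ring $\mathbb{Z}_{(p)}$ of $p$-integral rationals.
   Context: For integers $n\geq k\geq 0$ the incomplete exponential Bell polynomial is \[B_{n,k}(x_1,\dots,x_{n-k+1})=\sum_{\substack{(j_1,\dots,j_{n-k+1})\in\mathbb{N}^{n-k+1}\\ \sum_t j_t=k,\ \sum_t t j_t=n}}\frac{n!}{j_1!\cdots j_{n-k+1}!}\prod_{t=1}^{n-k+1}\left(\frac{x_t}{t!}\right)^{j_t}.\] The Stirling number of the second kind is $S(n,k)=B_{n,k}(1,1,\dots,1)$. For a positive integer $r$, the $r$-restricted Stirling number of the second kind is $S_{\leq r}(n,k)=S(n,k)$ if $n-k+1\leq r$, and $S_{\leq r}(n,k)=B_{n,k}(1,\dots,1,0,\dots,0)$ (first $r$ arguments equal to $1$, the rest $0$) otherwise. -}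

module Defs where

open import Data.Bool using (Bool; true; false; if_then_else_; _∧_)
open import Data.Nat as ℕ using (ℕ; zero; suc; _∸_; _!; _≡ᵇ_; _≤ᵇ_)
open import Data.Nat.Properties using (_!≢0)
open import Data.Nat.Divisibility using (_∣_)
open import Data.Integer using (+_)
open import Data.Rational using (ℚ; _/_; 0ℚ; 1ℚ; _+_; _*_; _-_)
open import Data.Product using (Σ; _×_)
open import Relation.Nullary using (¬_)
open import Relation.Binary.PropositionalEquality using (_≡_)

ℕtoℚ : ℕ → ℚ
ℕtoℚ n = + n / 1

invFact : ℕ → ℚ
invFact n = (+ 1 / (n !)) {{n !≢0}}

powℚ : ℚ → ℕ → ℚ
powℚ q zero    = 1ℚ
powℚ q (suc j) = q * powℚ q j

sumTo : ℕ → (ℕ → ℚ) → ℚ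
sumTo zero    f = f 0
sumTo (suc k) f = sumTo k f + f (suc k)

term : (ℕ → ℚ) → ℕ → ℕ → ℚ
term x t j = powℚ (x t * invFact t) j * invFact j

-- Bsum x t m k n = sum over (j_t, …, j_{t+m-1}) ∈ ℕ^m with Σ j_i = k and
-- Σ i j_i = n of  ∏_i (x_i / i!)^{j_i} / j_i!
Bsum : (ℕ → ℚ) → (t m k n : ℕ) → ℚ
Bsum x t zero    k n = if (k ≡ᵇ 0) ∧ (n ≡ᵇ 0) then 1ℚ else 0ℚ
Bsum x t (suc m) k n =
  sumTo k (λ j → if (t ℕ.* j) ≤ᵇ n
                 then term x t j * Bsum x (suc t) m (k ∸ j) (n ∸ (t ℕ.* j))
                 else 0ℚ)

-- incomplete exponential Bell polynomial B_{n,k}(x_1, …, x_{n-k+1})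
-- (the arguments x_t are read off the function x for t = 1 … n-k+1)
Bell : (n k : ℕ) → (ℕ → ℚ) → ℚ
Bell n k x = ℕtoℚ (n !) * Bsum x 1 (suc (n ∸ k)) k n

S : ℕ → ℕ → ℚ
S n k = Bell n k (λ _ → 1ℚ)

S≤ : (r n k : ℕ) → ℚ
S≤ r n k = if (suc (n ∸ k)) ≤ᵇ r
           then S n k
           else Bell n k (λ t → if t ≤ᵇ r then 1ℚ else 0ℚ)

pIntegral : ℕ → ℚ → Set
pIntegral p q = ¬ (p ∣ ℚ.denominatorℕ q)

CongMod : ℕ → ℚ → ℚ → Set
CongMod p a b = pIntegral p a × pIntegral p b ×
                Σ ℚ (λ c → pIntegral p c × (a - b ≡ ℕtoℚ p * c))

{-# OPTIONS --safe #-}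
module Submission where

-- Let c i = 1/i! for 1 ≤ i ≤ p - 1 and c i = 0 otherwise, and f(y) = Σ c i yⁱ.
-- Then (K!/N!) S_{≤p-1}(N,K) is the coefficient of y^N in f(y)^K.  The c i are
-- p-integral with c i ^ p ≡ c i (Fermat applied to i!), so "f(y)^(Kp) ≡ f(y^p)^K":
-- the coefficient of y^(Np) in f^(Kp) is ≡ that of y^N in f^K, and the coefficient
-- of y^N in f^(Kp) vanishes mod p when p ∤ N.  We prove these coefficient identities
-- by expanding in the number j of parts of one size at a time, which brings in
-- C(Kp, j); Lucas' congruences C(Kp, jp) ≡ C(K, j) and C(Kp, j) ≡ 0 (p ∤ j) then do
-- the work.  After n - 2 steps we reach the coefficient of y^q in f^s with q < p,
-- where the restriction to parts of size ≤ p - 1 is vacuous: that is (s!/q!) S(q, s).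

open import Defs

module BellCoefficients where
  open import Data.Bool using (true; false; if_then_else_; T; _∧_)
  open import Data.Empty using (⊥-elim)
  open import Data.Nat as ℕ
    using (ℕ; zero; suc; _≤_; _<_; s≤s; z≤n; _!; _∸_; _^_; _≤ᵇ_; _≡ᵇ_; NonZero)
  import Data.Nat.Properties as ℕP
  open import Data.Nat.Combinatorics using (_C_; nCk+nC[k+1]≡[n+1]C[k+1]; k>n⇒nCk≡0; nCn≡1)
  open import Data.Nat.Combinatorics.Specification using (nCk≡n!/k![n-k]!; [n∸k]!k!∣n!)
  open import Data.Nat.DivMod using (m/n*n≡m; _%_; m≡m%n+[m/n]*n; m%n<n) renaming (_/_ to _div_)
  open import Data.Nat.Divisibility as ∣ using (_∣_; divides; ∣-trans; m%n≡0⇒n∣m)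
  open import Data.Nat.Primality using (Prime; euclidsLemma)
  open import Data.Integer as ℤ using (ℤ; +_)
  import Data.Integer.Properties as ℤP
  open import Data.Rational as ℚ using (ℚ; _+_; _*_; _-_; -_; 0ℚ; 1ℚ; ↧_; ↧ₙ_; _/_; toℚᵘ; fromℚᵘ)
  import Data.Rational.Properties as ℚP
  open import Data.Rational.Unnormalised using (mkℚᵘ; *≡*) renaming (_+_ to _+ᵘ_; _*_ to _*ᵘ_)
  import Data.Rational.Unnormalised.Properties as ℚᵘP
  open import Data.Rational.Solver using (module +-*-Solver)
  open import Data.Product using (_×_; proj₁; proj₂) renaming (_,_ to _,,_)
  open import Data.Sum using (inj₁; inj₂)
  open import Data.Unit using (tt)
  open import Relation.Nullary using (¬_; yes; no)
  open import Relation.Binary.PropositionalEquality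
  open +-*-Solver

  private
    fromℚᵘ-+ : ∀ u v → fromℚᵘ (u +ᵘ v) ≡ fromℚᵘ u + fromℚᵘ v
    fromℚᵘ-+ u v = sym (begin
      fromℚᵘ u + fromℚᵘ v                           ≡⟨ ℚP.fromℚᵘ-toℚᵘ _ ⟨
      fromℚᵘ (toℚᵘ (fromℚᵘ u + fromℚᵘ v))           ≡⟨ ℚP.fromℚᵘ-cong (ℚP.toℚᵘ-homo-+ (fromℚᵘ u) (fromℚᵘ v)) ⟩
      fromℚᵘ (toℚᵘ (fromℚᵘ u) +ᵘ toℚᵘ (fromℚᵘ v))  ≡⟨ ℚP.fromℚᵘ-cong (ℚᵘP.+-cong (ℚP.toℚᵘ-fromℚᵘ u) (ℚP.toℚᵘ-fromℚᵘ v)) ⟩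
      fromℚᵘ (u +ᵘ v)                               ∎)
      where open ≡-Reasoning

    fromℚᵘ-* : ∀ u v → fromℚᵘ (u *ᵘ v) ≡ fromℚᵘ u * fromℚᵘ v
    fromℚᵘ-* u v = sym (begin
      fromℚᵘ u * fromℚᵘ v                           ≡⟨ ℚP.fromℚᵘ-toℚᵘ _ ⟨
      fromℚᵘ (toℚᵘ (fromℚᵘ u * fromℚᵘ v))           ≡⟨ ℚP.fromℚᵘ-cong (ℚP.toℚᵘ-homo-* (fromℚᵘ u) (fromℚᵘ v)) ⟩
      fromℚᵘ (toℚᵘ (fromℚᵘ u) *ᵘ toℚᵘ (fromℚᵘ v))  ≡⟨ ℚP.fromℚᵘ-cong (ℚᵘP.*-cong (ℚP.toℚᵘ-fromℚᵘ u) (ℚP.toℚᵘ-fromℚᵘ v)) ⟩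
      fromℚᵘ (u *ᵘ v)                               ∎)
      where open ≡-Reasoning

  ℕtoℚ-+ : ∀ a b → ℕtoℚ (a ℕ.+ b) ≡ ℕtoℚ a + ℕtoℚ b
  ℕtoℚ-+ a b = trans (ℚP.fromℚᵘ-cong {mkℚᵘ (+ (a ℕ.+ b)) 0} {mkℚᵘ (+ a) 0 +ᵘ mkℚᵘ (+ b) 0} (*≡* eq)) (fromℚᵘ-+ (mkℚᵘ (+ a) 0) (mkℚᵘ (+ b) 0))
    where
    eq : + (a ℕ.+ b) ℤ.* + 1 ≡ (+ a ℤ.* + 1 ℤ.+ + b ℤ.* + 1) ℤ.* + 1
    eq rewrite ℤP.*-identityʳ (+ a) | ℤP.*-identityʳ (+ b) | ℤP.*-identityʳ (+ a ℤ.+ + b) = ℤP.pos-+ a b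

  ℕtoℚ-* : ∀ a b → ℕtoℚ (a ℕ.* b) ≡ ℕtoℚ a * ℕtoℚ b
  ℕtoℚ-* a b = trans (ℚP.fromℚᵘ-cong {mkℚᵘ (+ (a ℕ.* b)) 0} {mkℚᵘ (+ a) 0 *ᵘ mkℚᵘ (+ b) 0} (*≡* eq)) (fromℚᵘ-* (mkℚᵘ (+ a) 0) (mkℚᵘ (+ b) 0))
    where
    eq : + (a ℕ.* b) ℤ.* + 1 ≡ (+ a ℤ.* + b) ℤ.* + 1
    eq rewrite ℤP.*-identityʳ (+ (a ℕ.* b)) | ℤP.*-identityʳ (+ a ℤ.* + b) = ℤP.pos-* a b

  ℕtoℚ-*-1/ : ∀ n .{{_ : NonZero n}} → ℕtoℚ n * (+ 1 / n) ≡ 1ℚ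
  ℕtoℚ-*-1/ (suc a) = trans (sym (fromℚᵘ-* (mkℚᵘ (+ suc a) 0) (mkℚᵘ (+ 1) a))) (ℚP.fromℚᵘ-cong {mkℚᵘ (+ suc a) 0 *ᵘ mkℚᵘ (+ 1) a} {mkℚᵘ (+ 1) 0} (*≡* eq))
    where
    eq : (+ suc a ℤ.* + 1) ℤ.* + 1 ≡ + 1 ℤ.* + (1 ℕ.* suc a)
    eq = trans (ℤP.*-identityʳ _) (trans (ℤP.*-identityʳ _) (trans (cong +_ (sym (ℕP.*-identityˡ (suc a)))) (sym (ℤP.*-identityˡ _))))

  n!*invFact≡1 : ∀ n → ℕtoℚ (n !) * invFact n ≡ 1ℚ
  n!*invFact≡1 n = ℕtoℚ-*-1/ (n !) {{n ℕP.!≢0}}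

  if-elim : ∀ (P : ℚ → Set) b {u v} → (b ≡ true → P u) → (b ≡ false → P v) → P (if b then u else v)
  if-elim P true  f g = f refl
  if-elim P false f g = g refl

  if-elim₂ : ∀ (R : ℚ → ℚ → Set) b {u v u′ v′} →
             (b ≡ true → R u u′) → (b ≡ false → R v v′) → R (if b then u else v) (if b then u′ else v′)
  if-elim₂ R true  f g = f refl
  if-elim₂ R false f g = g refl

  ≡true⇒T : ∀ {b} → b ≡ true → T b
  ≡true⇒T refl = tt

  ≡false⇒¬T : ∀ {b} → b ≡ false → ¬ T b
  ≡false⇒¬T refl ()

  sumTo-cong : ∀ n {f g} → (∀ j → j ≤ n → f j ≡ g j) → sumTo n f ≡ sumTo n g
  sumTo-cong zero    h = h 0 z≤n
  sumTo-cong (suc n) h = cong₂ _+_ (sumTo-cong n (λ j j≤n → h j (ℕP.m≤n⇒m≤1+n j≤n))) (h (suc n) ℕP.≤-refl)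

  sumTo-zero : ∀ n → sumTo n (λ _ → 0ℚ) ≡ 0ℚ
  sumTo-zero zero    = refl
  sumTo-zero (suc n) = trans (cong (_+ 0ℚ) (sumTo-zero n)) (ℚP.+-identityʳ 0ℚ)

  sumTo-suc-head : ∀ n f → sumTo (suc n) f ≡ f 0 + sumTo n (λ j → f (suc j))
  sumTo-suc-head zero    f = refl
  sumTo-suc-head (suc n) f = trans (cong (_+ f (suc (suc n))) (sumTo-suc-head n f)) (ℚP.+-assoc (f 0) _ _)

  sumTo-split : ∀ r n f → sumTo (suc r ℕ.+ n) f ≡ sumTo n f + sumTo r (λ i → f (suc i ℕ.+ n))
  sumTo-split zero    n f = refl
  sumTo-split (suc r) n f = trans (cong (_+ f (suc (suc r) ℕ.+ n)) (sumTo-split r n f)) (ℚP.+-assoc (sumTo n f) _ _)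

  sumTo-+ : ∀ n f g → sumTo n (λ j → f j + g j) ≡ sumTo n f + sumTo n g
  sumTo-+ zero    f g = refl
  sumTo-+ (suc n) f g = trans (cong (_+ (f (suc n) + g (suc n))) (sumTo-+ n f g))
    (solve 4 (λ a b c d → (a :+ b) :+ (c :+ d) := (a :+ c) :+ (b :+ d)) refl (sumTo n f) (sumTo n g) (f (suc n)) (g (suc n)))

  sumTo-distribˡ : ∀ n a f → a * sumTo n f ≡ sumTo n (λ j → a * f j)
  sumTo-distribˡ zero    a f = refl
  sumTo-distribˡ (suc n) a f = trans (ℚP.*-distribˡ-+ a _ _) (cong (_+ a * f (suc n)) (sumTo-distribˡ n a f))

  powℚ-distrib-* : ∀ a b n → powℚ (a * b) n ≡ powℚ a n * powℚ b n
  powℚ-distrib-* a b zero    = sym (ℚP.*-identityˡ 1ℚ)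
  powℚ-distrib-* a b (suc n) = trans (cong ((a * b) *_) (powℚ-distrib-* a b n))
    (solve 4 (λ a b c d → (a :* b) :* (c :* d) := (a :* c) :* (b :* d)) refl a b (powℚ a n) (powℚ b n))

  powℚ-1ℚ : ∀ n → powℚ 1ℚ n ≡ 1ℚ
  powℚ-1ℚ zero    = refl
  powℚ-1ℚ (suc n) = trans (cong (1ℚ *_) (powℚ-1ℚ n)) (ℚP.*-identityˡ 1ℚ)

  powℚ-+ : ∀ a m n → powℚ a (m ℕ.+ n) ≡ powℚ a m * powℚ a n
  powℚ-+ a zero    n = sym (ℚP.*-identityˡ _)
  powℚ-+ a (suc m) n = trans (cong (a *_) (powℚ-+ a m n)) (sym (ℚP.*-assoc a _ _))

  powℚ-* : ∀ a d m → powℚ a (d ℕ.* m) ≡ powℚ (powℚ a m) d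
  powℚ-* a zero    m = refl
  powℚ-* a (suc d) m = trans (powℚ-+ a m (d ℕ.* m)) (cong (powℚ a m *_) (powℚ-* a d m))

  nCk*[k!*[n∸k]!]≡n! : ∀ n j → j ≤ n → (n C j) ℕ.* (j ! ℕ.* (n ∸ j) !) ≡ n !
  nCk*[k!*[n∸k]!]≡n! n j j≤n = trans (cong (ℕ._* (j ! ℕ.* (n ∸ j) !)) (nCk≡n!/k![n-k]! j≤n))
    (m/n*n≡m {{j ℕP.!* (n ∸ j) !≢0}} (subst (_∣ n !) (ℕP.*-comm ((n ∸ j) !) (j !)) ([n∸k]!k!∣n! j≤n)))

  Cℚ : ℕ → ℕ → ℚ
  Cℚ n j = ℕtoℚ (n C j)

  pascalℚ : ∀ n j → Cℚ n j + Cℚ n (suc j) ≡ Cℚ (suc n) (suc j)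
  pascalℚ n j = trans (sym (ℕtoℚ-+ (n C j) (n C suc j))) (cong ℕtoℚ (nCk+nC[k+1]≡[n+1]C[k+1] n j))

  binomial-theorem : ∀ a n → powℚ (a + 1ℚ) n ≡ sumTo n (λ j → Cℚ n j * powℚ a j)
  binomial-theorem a zero    = sym (ℚP.*-identityˡ 1ℚ)
  binomial-theorem a (suc n) = begin
    (a + 1ℚ) * powℚ (a + 1ℚ) n  ≡⟨ cong ((a + 1ℚ) *_) (binomial-theorem a n) ⟩
    (a + 1ℚ) * Bn               ≡⟨ solve 2 (λ a b → (a :+ con 1ℚ) :* b := a :* b :+ b) refl a Bn ⟩
    a * Bn + Bn                 ≡⟨ cong₂ _+_ aBn≡S₁ Bn≡1+S₂ ⟩
    S₁ + (1ℚ + S₂)              ≡⟨ solve 2 (λ x y → x :+ (con 1ℚ :+ y) := con 1ℚ :+ (x :+ y)) refl S₁ S₂ ⟩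
    1ℚ + (S₁ + S₂)              ≡⟨ cong (λ z → 1ℚ + z) (trans (sym (sumTo-+ n _ _)) (sumTo-cong n pascal-term)) ⟩
    1ℚ + sumTo n (λ j → Cℚ (suc n) (suc j) * powℚ a (suc j))
                                ≡⟨ cong (_+ sumTo n (λ j → Cℚ (suc n) (suc j) * powℚ a (suc j))) (sym (ℚP.*-identityˡ 1ℚ)) ⟩
    Cℚ (suc n) 0 * powℚ a 0 + sumTo n (λ j → Cℚ (suc n) (suc j) * powℚ a (suc j))
                                ≡⟨ sumTo-suc-head n (λ j → Cℚ (suc n) j * powℚ a j) ⟨
    sumTo (suc n) (λ j → Cℚ (suc n) j * powℚ a j) ∎
    where
    open ≡-Reasoning
    Bn : ℚ
    Bn = sumTo n (λ j → Cℚ n j * powℚ a j)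
    S₁ : ℚ
    S₁ = sumTo n (λ j → Cℚ n j * powℚ a (suc j))
    S₂ : ℚ
    S₂ = sumTo n (λ j → Cℚ n (suc j) * powℚ a (suc j))
    aBn≡S₁ : a * Bn ≡ S₁
    aBn≡S₁ = trans (sumTo-distribˡ n a _) (sumTo-cong n (λ j _ →
      solve 3 (λ a b c → a :* (b :* c) := b :* (a :* c)) refl a (Cℚ n j) (powℚ a j)))
    Bn≡1+S₂ : Bn ≡ 1ℚ + S₂
    Bn≡1+S₂ = begin
      Bn                                       ≡⟨ ℚP.+-identityʳ Bn ⟨
      Bn + 0ℚ                                  ≡⟨ cong (λ z → Bn + z) (sym (trans (cong (λ z → ℕtoℚ z * powℚ a (suc n)) (k>n⇒nCk≡0 (ℕP.n<1+n n))) (ℚP.*-zeroˡ (powℚ a (suc n))))) ⟩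
      sumTo (suc n) (λ j → Cℚ n j * powℚ a j)  ≡⟨ sumTo-suc-head n _ ⟩
      Cℚ n 0 * powℚ a 0 + S₂                   ≡⟨ cong (_+ S₂) (ℚP.*-identityˡ 1ℚ) ⟩
      1ℚ + S₂                                  ∎
    pascal-term : ∀ j → j ≤ n → Cℚ n j * powℚ a (suc j) + Cℚ n (suc j) * powℚ a (suc j) ≡ Cℚ (suc n) (suc j) * powℚ a (suc j)
    pascal-term j _ = trans (sym (ℚP.*-distribʳ-+ (powℚ a (suc j)) (Cℚ n j) (Cℚ n (suc j)))) (cong (_* powℚ a (suc j)) (pascalℚ n j))

  Bsum-cong : ∀ x y t m K N → (∀ i → t ≤ i → i < t ℕ.+ m → x i ≡ y i) → Bsum x t m K N ≡ Bsum y t m K N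
  Bsum-cong x y t zero    K N h = refl
  Bsum-cong x y t (suc m) K N h = sumTo-cong K λ j _ →
    cong₂ (λ a b → if t ℕ.* j ≤ᵇ N then powℚ (a * invFact t) j * invFact j * b else 0ℚ)
      (h t ℕP.≤-refl (subst (t <_) (sym (ℕP.+-suc t m)) (s≤s (ℕP.m≤m+n t m))))
      (Bsum-cong x y (suc t) m (K ∸ j) (N ∸ t ℕ.* j)
        (λ i t<i i<t+m → h i (ℕP.<⇒≤ t<i) (subst (i <_) (sym (ℕP.+-suc t m)) i<t+m)))

  Bell-cong : ∀ N K x y → (∀ i → 1 ≤ i → i ≤ suc (N ∸ K) → x i ≡ y i) → Bell N K x ≡ Bell N K y
  Bell-cong N K x y h = cong (ℕtoℚ (N !) *_) (Bsum-cong x y 1 (suc (N ∸ K)) K N (λ i 1≤i i< → h i 1≤i (ℕP.≤-pred i<)))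

  -- A part of the largest size 1 + t + m would force N ≥ (1 + t + m) + (K - 1), as all parts have size ≥ 1.
  Bsum-drop-last : ∀ x m t K N → suc N < suc t ℕ.+ m ℕ.+ K → Bsum x (suc t) (suc m) K N ≡ Bsum x (suc t) m K N
  Bsum-drop-last x zero t zero N _ rewrite ℕP.*-zeroʳ t =
    trans (cong (_* Bsum x (suc (suc t)) 0 0 N) (ℚP.*-identityˡ 1ℚ)) (ℚP.*-identityˡ _)
  Bsum-drop-last x zero t (suc K) N N<t+K = trans (sumTo-cong (suc K) no-last-part) (sumTo-zero (suc K))
    where
    no-last-part : ∀ j → j ≤ suc K →
      (if suc t ℕ.* j ≤ᵇ N then term x (suc t) j * Bsum x (suc (suc t)) 0 (suc K ∸ j) (N ∸ suc t ℕ.* j) else 0ℚ) ≡ 0ℚ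
    no-last-part j _ with suc t ℕ.* j ≤ᵇ N in fits | suc K ∸ j in rest
    ... | false | _     = refl
    ... | true  | suc _ = ℚP.*-zeroʳ (term x (suc t) j)
    ... | true  | zero  = ⊥-elim (ℕP.<⇒≱ N<t+K (s≤s t+K≤N))
      where
      t+K≤N : t ℕ.+ 0 ℕ.+ suc K ≤ N
      t+K≤N = ℕP.≤-trans (ℕP.≤-reflexive (trans (cong (ℕ._+ suc K) (ℕP.+-identityʳ t)) (ℕP.+-comm t (suc K))))
                (ℕP.≤-trans (ℕP.+-monoʳ-≤ (suc K) (ℕP.m≤m*n t (suc K)))
                  (ℕP.≤-trans (ℕP.*-monoʳ-≤ (suc t) (ℕP.m∸n≡0⇒m≤n {suc K} {j} rest)) (ℕP.≤ᵇ⇒≤ _ N (≡true⇒T fits))))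
  Bsum-drop-last x (suc m) t K N N<t+m+K = sumTo-cong K λ j j≤K →
    cong (λ B → if suc t ℕ.* j ≤ᵇ N then term x (suc t) j * B else 0ℚ)
      (Bsum-drop-last x m (suc t) (K ∸ j) (N ∸ suc t ℕ.* j) (s≤s (s≤s (budget j j≤K))))
    where
    N≤t+m+K : N ≤ t ℕ.+ m ℕ.+ K
    N≤t+m+K = ℕP.≤-pred (ℕP.≤-pred (subst (suc (suc N) ≤_) (cong (λ z → suc (z ℕ.+ K)) (ℕP.+-suc t m)) N<t+m+K))
    budget : ∀ j → j ≤ K → N ∸ suc t ℕ.* j ≤ t ℕ.+ m ℕ.+ (K ∸ j)
    budget j j≤K = ℕP.≤-trans (ℕP.∸-monoʳ-≤ N (ℕP.m≤n*m j (suc t)))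
      (ℕP.≤-trans (ℕP.∸-monoˡ-≤ j N≤t+m+K) (ℕP.≤-reflexive (ℕP.+-∸-assoc (t ℕ.+ m) j≤K)))

  Bsum-drop-lasts : ∀ x r m t K N → suc N < suc t ℕ.+ m ℕ.+ K → Bsum x (suc t) (r ℕ.+ m) K N ≡ Bsum x (suc t) m K N
  Bsum-drop-lasts x zero    m t K N fits = refl
  Bsum-drop-lasts x (suc r) m t K N fits =
    trans (Bsum-drop-last x (r ℕ.+ m) t K N (ℕP.<-≤-trans fits (ℕP.+-monoˡ-≤ K (ℕP.+-monoʳ-≤ (suc t) (ℕP.m≤n+m m r)))))
          (Bsum-drop-lasts x r m t K N fits)

  weight : (ℕ → ℚ) → ℕ → ℚ
  weight x t = x t * invFact t

  -- coeff x t m K N is the coefficient of y^N in (Σ_{t ≤ i < t+m} weight x i · yⁱ)^K.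
  coeff : (ℕ → ℚ) → (t m K N : ℕ) → ℚ
  coeff x t m K N = ℕtoℚ (K !) * Bsum x t m K N

  coeff-term : (ℕ → ℚ) → (t m K N j : ℕ) → ℚ
  coeff-term x t m K N j =
    if t ℕ.* j ≤ᵇ N then Cℚ K j * powℚ (weight x t) j * coeff x (suc t) m (K ∸ j) (N ∸ t ℕ.* j) else 0ℚ

  coeff-expand : ∀ x t m K N → coeff x t (suc m) K N ≡ sumTo K (coeff-term x t m K N)
  coeff-expand x t m K N = trans (sumTo-distribˡ K (ℕtoℚ (K !)) _) (sumTo-cong K expand-term)
    where
    expand-term : ∀ j → j ≤ K →
      ℕtoℚ (K !) * (if t ℕ.* j ≤ᵇ N then term x t j * Bsum x (suc t) m (K ∸ j) (N ∸ t ℕ.* j) else 0ℚ) ≡ coeff-term x t m K N j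
    expand-term j j≤K = if-elim₂ (λ u v → ℕtoℚ (K !) * u ≡ v) (t ℕ.* j ≤ᵇ N) (λ _ → split-factorial) (λ _ → ℚP.*-zeroʳ (ℕtoℚ (K !)))
      where
      open ≡-Reasoning
      w : ℚ
      w = powℚ (weight x t) j
      B : ℚ
      B = Bsum x (suc t) m (K ∸ j) (N ∸ t ℕ.* j)
      split-factorial : ℕtoℚ (K !) * (w * invFact j * B) ≡ Cℚ K j * w * coeff x (suc t) m (K ∸ j) (N ∸ t ℕ.* j)
      split-factorial = begin
        ℕtoℚ (K !) * (w * invFact j * B)
          ≡⟨ cong (λ z → ℕtoℚ z * (w * invFact j * B)) (sym (nCk*[k!*[n∸k]!]≡n! K j j≤K)) ⟩
        ℕtoℚ ((K C j) ℕ.* (j ! ℕ.* (K ∸ j) !)) * (w * invFact j * B)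
          ≡⟨ cong (_* (w * invFact j * B)) (trans (ℕtoℚ-* (K C j) _) (cong (Cℚ K j *_) (ℕtoℚ-* (j !) ((K ∸ j) !)))) ⟩
        Cℚ K j * (ℕtoℚ (j !) * ℕtoℚ ((K ∸ j) !)) * (w * invFact j * B)
          ≡⟨ solve 6 (λ c J R w i B → c :* (J :* R) :* (w :* i :* B) := (c :* w :* (R :* B)) :* (J :* i)) refl
                   (Cℚ K j) (ℕtoℚ (j !)) (ℕtoℚ ((K ∸ j) !)) w (invFact j) B ⟩
        (Cℚ K j * w * coeff x (suc t) m (K ∸ j) (N ∸ t ℕ.* j)) * (ℕtoℚ (j !) * invFact j)
          ≡⟨ cong (Cℚ K j * w * coeff x (suc t) m (K ∸ j) (N ∸ t ℕ.* j) *_) (n!*invFact≡1 j) ⟩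
        (Cℚ K j * w * coeff x (suc t) m (K ∸ j) (N ∸ t ℕ.* j)) * 1ℚ
          ≡⟨ ℚP.*-identityʳ _ ⟩
        Cℚ K j * w * coeff x (suc t) m (K ∸ j) (N ∸ t ℕ.* j) ∎

  scaled-Bell≡coeff : ∀ N K x → ℕtoℚ (K !) * invFact N * Bell N K x ≡ coeff x 1 (suc (N ∸ K)) K N
  scaled-Bell≡coeff N K x =
    trans (solve 4 (λ a i f b → a :* i :* (f :* b) := (a :* b) :* (f :* i)) refl (ℕtoℚ (K !)) (invFact N) (ℕtoℚ (N !)) B)
          (trans (cong (ℕtoℚ (K !) * B *_) (n!*invFact≡1 N)) (ℚP.*-identityʳ _))
    where
    B : ℚ
    B = Bsum x 1 (suc (N ∸ K)) K N

  coeff-widen : ∀ x M K N → K ≤ N → suc (N ∸ K) ≤ M → coeff x 1 M K N ≡ coeff x 1 (suc (N ∸ K)) K N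
  coeff-widen x M K N K≤N width≤M = cong (ℕtoℚ (K !) *_)
    (trans (cong (λ z → Bsum x 1 z K N) (sym (ℕP.m∸n+n≡m width≤M)))
           (Bsum-drop-lasts x (M ∸ suc (N ∸ K)) (suc (N ∸ K)) 0 K N
             (ℕP.≤-reflexive (sym (cong (λ z → suc (suc z)) (ℕP.m∸n+n≡m K≤N))))))

  -- p is written suc (suc k), so that p ∸ 1 reduces to suc k.
  module ModPrime (k : ℕ) (prime : Prime (suc (suc k))) where

    p : ℕ
    p = suc (suc k)

    0<m<p⇒p∤m : ∀ {m} → 0 < m → m < p → ¬ (p ∣ m)
    0<m<p⇒p∤m {suc m} _ m<p p∣m = ℕP.<⇒≱ m<p (∣.∣⇒≤ p∣m)

    p∤1 : ¬ (p ∣ 1)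
    p∤1 = 0<m<p⇒p∤m (s≤s z≤n) (s≤s (s≤s z≤n))

    p∤* : ∀ {a b} → ¬ (p ∣ a) → ¬ (p ∣ b) → ¬ (p ∣ a ℕ.* b)
    p∤* {a} {b} p∤a p∤b p∣ab with euclidsLemma a b prime p∣ab
    ... | inj₁ p∣a = p∤a p∣a
    ... | inj₂ p∣b = p∤b p∣b

    p∤n! : ∀ n → n < p → ¬ (p ∣ n !)
    p∤n! zero    _    = p∤1
    p∤n! (suc n) n<p = p∤* (0<m<p⇒p∤m (s≤s z≤n) n<p) (p∤n! n (ℕP.<-trans (ℕP.n<1+n n) n<p))

    -- A record (rather than pIntegral p q) so that q can be recovered from Integral q by unification.
    record Integral (q : ℚ) : Set where
      constructor integral
      field p∤denominator : ¬ (p ∣ ↧ₙ q)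

    ↧ₙ∣ : ∀ q (g : ℤ) m → ↧ q ℤ.* g ≡ + m → ↧ₙ q ∣ m
    ↧ₙ∣ q g m eq = divides ℤ.∣ g ∣ (trans (sym (cong ℤ.∣_∣ eq)) (trans (ℤP.abs-* (↧ q) g) (ℕP.*-comm (↧ₙ q) _)))

    integral-∣ : ∀ q m → ↧ₙ q ∣ m → ¬ (p ∣ m) → Integral q
    integral-∣ q m d p∤m = integral λ p∣d → p∤m (∣-trans p∣d d)

    integral-/ : ∀ i m .{{_ : NonZero m}} → ¬ (p ∣ m) → Integral (i / m)
    integral-/ i m = integral-∣ (i / m) m (↧ₙ∣ (i / m) _ m (ℚP.↧-/ i m))

    integral-+ : ∀ {a b} → Integral a → Integral b → Integral (a + b)
    integral-+ {a} {b} (integral ia) (integral ib) = integral-∣ (a + b) _ (↧ₙ∣ (a + b) _ _ (ℚP.↧-+ a b)) (p∤* ia ib)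

    integral-* : ∀ {a b} → Integral a → Integral b → Integral (a * b)
    integral-* {a} {b} (integral ia) (integral ib) = integral-∣ (a * b) _ (↧ₙ∣ (a * b) _ _ (ℚP.↧-* a b)) (p∤* ia ib)

    integral-neg : ∀ {a} → Integral a → Integral (- a)
    integral-neg {a} (integral ia) = integral λ p∣d → ia (subst (p ∣_) (ℤP.+-injective (ℚP.↧-neg a)) p∣d)

    integral-ℕ : ∀ n → Integral (ℕtoℚ n)
    integral-ℕ n = integral-/ (+ n) 1 p∤1

    integral-pow : ∀ {a} n → Integral a → Integral (powℚ a n)
    integral-pow zero    _  = integral-ℕ 1
    integral-pow (suc n) ia = integral-* ia (integral-pow n ia)

    integral-sumTo : ∀ n f → (∀ j → j ≤ n → Integral (f j)) → Integral (sumTo n f)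
    integral-sumTo zero    f h = h 0 z≤n
    integral-sumTo (suc n) f h = integral-+ (integral-sumTo n f (λ j j≤n → h j (ℕP.m≤n⇒m≤1+n j≤n))) (h (suc n) ℕP.≤-refl)

    integral-invFact : ∀ n → n < p → Integral (invFact n)
    integral-invFact n n<p = integral-/ (+ 1) (n !) {{n ℕP.!≢0}} (p∤n! n n<p)

    pℚ : ℚ
    pℚ = ℕtoℚ p

    infix 4 _≡ₚ_
    record _≡ₚ_ (a b : ℚ) : Set where
      constructor mk≡ₚ
      field
        quotient  : ℚ
        quotient-integral : Integral quotient
        difference : a - b ≡ pℚ * quotient

    toCongMod-≡ₚ : ∀ {a b} → Integral a → Integral b → a ≡ₚ b → CongMod p a b
    toCongMod-≡ₚ (integral ia) (integral ib) (mk≡ₚ c (integral ic) eq) = ia ,, ib ,, (c ,, ic ,, eq)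

    ≡ₚ-reflexive : ∀ {a b} → a ≡ b → a ≡ₚ b
    ≡ₚ-reflexive {a} refl = mk≡ₚ 0ℚ (integral-ℕ 0) (trans (solve 1 (λ a → a :- a := con 0ℚ) refl a) (sym (ℚP.*-zeroʳ pℚ)))

    ≡ₚ-refl : ∀ {a} → a ≡ₚ a
    ≡ₚ-refl = ≡ₚ-reflexive refl

    ≡ₚ-sym : ∀ {a b} → a ≡ₚ b → b ≡ₚ a
    ≡ₚ-sym {a} {b} (mk≡ₚ c ic eq) = mk≡ₚ (- c) (integral-neg ic) (begin
      b - a      ≡⟨ solve 2 (λ a b → b :- a := :- (a :- b)) refl a b ⟩
      - (a - b)  ≡⟨ cong -_ eq ⟩
      - (pℚ * c)  ≡⟨ solve 2 (λ pℚ c → :- (pℚ :* c) := pℚ :* (:- c)) refl pℚ c ⟩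
      pℚ * (- c)  ∎)
      where open ≡-Reasoning

    ≡ₚ-trans : ∀ {a b d} → a ≡ₚ b → b ≡ₚ d → a ≡ₚ d
    ≡ₚ-trans {a} {b} {d} (mk≡ₚ c ic eq) (mk≡ₚ e ie eq′) = mk≡ₚ (c + e) (integral-+ ic ie) (begin
      a - d              ≡⟨ solve 3 (λ a b d → a :- d := (a :- b) :+ (b :- d)) refl a b d ⟩
      (a - b) + (b - d)  ≡⟨ cong₂ _+_ eq eq′ ⟩
      pℚ * c + pℚ * e      ≡⟨ ℚP.*-distribˡ-+ pℚ c e ⟨
      pℚ * (c + e)        ∎)
      where open ≡-Reasoning

    ≡ₚ-+ : ∀ {a b a′ b′} → a ≡ₚ b → a′ ≡ₚ b′ → a + a′ ≡ₚ b + b′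
    ≡ₚ-+ {a} {b} {a′} {b′} (mk≡ₚ c ic eq) (mk≡ₚ e ie eq′) = mk≡ₚ (c + e) (integral-+ ic ie) (begin
      (a + a′) - (b + b′)  ≡⟨ solve 4 (λ a b a′ b′ → (a :+ a′) :- (b :+ b′) := (a :- b) :+ (a′ :- b′)) refl a b a′ b′ ⟩
      (a - b) + (a′ - b′)  ≡⟨ cong₂ _+_ eq eq′ ⟩
      pℚ * c + pℚ * e        ≡⟨ ℚP.*-distribˡ-+ pℚ c e ⟨
      pℚ * (c + e)          ∎)
      where open ≡-Reasoning

    ≡ₚ-* : ∀ {a b a′ b′} → Integral a → Integral b′ → a ≡ₚ b → a′ ≡ₚ b′ → a * a′ ≡ₚ b * b′
    ≡ₚ-* {a} {b} {a′} {b′} ia ib′ (mk≡ₚ c ic eq) (mk≡ₚ e ie eq′) =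
      mk≡ₚ (a * e + c * b′) (integral-+ (integral-* ia ie) (integral-* ic ib′)) (begin
        (a * a′) - (b * b′)           ≡⟨ solve 4 (λ a b a′ b′ → (a :* a′) :- (b :* b′) := a :* (a′ :- b′) :+ (a :- b) :* b′) refl a b a′ b′ ⟩
        a * (a′ - b′) + (a - b) * b′  ≡⟨ cong₂ (λ u v → a * u + v * b′) eq′ eq ⟩
        a * (pℚ * e) + (pℚ * c) * b′    ≡⟨ solve 5 (λ a pℚ e c b′ → a :* (pℚ :* e) :+ (pℚ :* c) :* b′ := pℚ :* (a :* e :+ c :* b′)) refl a pℚ e c b′ ⟩
        pℚ * (a * e + c * b′)          ∎)
      where open ≡-Reasoning

    ≡ₚ-*ˡ : ∀ {a a′ b′} → Integral a → a′ ≡ₚ b′ → a * a′ ≡ₚ a * b′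
    ≡ₚ-*ˡ {a} {a′} {b′} ia (mk≡ₚ e ie eq) = mk≡ₚ (a * e) (integral-* ia ie) (begin
      (a * a′) - (a * b′)  ≡⟨ solve 3 (λ a a′ b′ → (a :* a′) :- (a :* b′) := a :* (a′ :- b′)) refl a a′ b′ ⟩
      a * (a′ - b′)        ≡⟨ cong (a *_) eq ⟩
      a * (pℚ * e)          ≡⟨ solve 3 (λ a pℚ e → a :* (pℚ :* e) := pℚ :* (a :* e)) refl a pℚ e ⟩
      pℚ * (a * e)          ∎)
      where open ≡-Reasoning

    ≡ₚ0-*ˡ : ∀ {a b} → Integral b → a ≡ₚ 0ℚ → b * a ≡ₚ 0ℚ
    ≡ₚ0-*ˡ {a} {b} ib h = subst (b * a ≡ₚ_) (ℚP.*-zeroʳ b) (≡ₚ-*ˡ ib h)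

    ≡ₚ0-*ʳ : ∀ {a b} → Integral b → a ≡ₚ 0ℚ → a * b ≡ₚ 0ℚ
    ≡ₚ0-*ʳ {a} {b} ib h = subst₂ _≡ₚ_ (ℚP.*-comm b a) (ℚP.*-zeroʳ b) (≡ₚ-*ˡ ib h)

    p∣⇒≡ₚ0 : ∀ {m} → p ∣ m → ℕtoℚ m ≡ₚ 0ℚ
    p∣⇒≡ₚ0 (divides q refl) = mk≡ₚ (ℕtoℚ q) (integral-ℕ q) (begin
      ℕtoℚ (q ℕ.* p) - 0ℚ  ≡⟨ cong (_- 0ℚ) (ℕtoℚ-* q p) ⟩
      ℕtoℚ q * pℚ - 0ℚ      ≡⟨ solve 2 (λ q pℚ → q :* pℚ :- con 0ℚ := pℚ :* q) refl (ℕtoℚ q) pℚ ⟩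
      pℚ * ℕtoℚ q           ∎)
      where open ≡-Reasoning

    ≡ₚ-sumTo : ∀ n {f g} → (∀ j → j ≤ n → f j ≡ₚ g j) → sumTo n f ≡ₚ sumTo n g
    ≡ₚ-sumTo zero    h = h 0 z≤n
    ≡ₚ-sumTo (suc n) h = ≡ₚ-+ (≡ₚ-sumTo n (λ j j≤n → h j (ℕP.m≤n⇒m≤1+n j≤n))) (h (suc n) ℕP.≤-refl)

    sumTo-≡ₚ0 : ∀ n {f} → (∀ j → j ≤ n → f j ≡ₚ 0ℚ) → sumTo n f ≡ₚ 0ℚ
    sumTo-≡ₚ0 n {f} h = subst (sumTo n f ≡ₚ_) (sumTo-zero n) (≡ₚ-sumTo n h)

    sumTo-≡ₚ-last : ∀ r g → (∀ j → j ≤ r → g j ≡ₚ 0ℚ) → sumTo (suc r) g ≡ₚ g (suc r)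
    sumTo-≡ₚ-last r g h = subst (sumTo (suc r) g ≡ₚ_) (ℚP.+-identityˡ (g (suc r))) (≡ₚ-+ (sumTo-≡ₚ0 r h) ≡ₚ-refl)

    ≡ₚ-pow : ∀ {a b} n → Integral a → Integral b → a ≡ₚ b → powℚ a n ≡ₚ powℚ b n
    ≡ₚ-pow zero    ia ib h = ≡ₚ-refl
    ≡ₚ-pow (suc n) ia ib h = ≡ₚ-* ia (integral-pow n ib) h (≡ₚ-pow n ia ib h)

    p∣pCj : ∀ j → 0 < j → j < p → p ∣ p C j
    p∣pCj j 0<j j<p with euclidsLemma (p C j) (j ! ℕ.* (p ∸ j) !) prime
                           (subst (p ∣_) (sym (nCk*[k!*[n∸k]!]≡n! p j (ℕP.<⇒≤ j<p))) (∣.m∣m*n (suc k !)))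
    ... | inj₁ p∣pCj  = p∣pCj
    ... | inj₂ p∣j!*r = ⊥-elim (p∤* (p∤n! j j<p) (p∤n! (p ∸ j) (ℕP.∸-monoʳ-< 0<j (ℕP.<⇒≤ j<p))) p∣j!*r)

    [n+p]Cj≡ₚnCj : ∀ n j → j < p → Cℚ (n ℕ.+ p) j ≡ₚ Cℚ n j
    [n+p]Cj≡ₚnCj zero    zero    _   = ≡ₚ-refl
    [n+p]Cj≡ₚnCj zero    (suc j) j<p = p∣⇒≡ₚ0 (p∣pCj (suc j) (s≤s z≤n) j<p)
    [n+p]Cj≡ₚnCj (suc n) zero    _   = ≡ₚ-refl
    [n+p]Cj≡ₚnCj (suc n) (suc j) j<p = subst₂ _≡ₚ_ (pascalℚ (n ℕ.+ p) j) (pascalℚ n j)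
      (≡ₚ-+ ([n+p]Cj≡ₚnCj n j (ℕP.<-trans (ℕP.n<1+n j) j<p)) ([n+p]Cj≡ₚnCj n (suc j) j<p))

    [n+p]C[j+p]≡ₚnC[j+p]+nCj : ∀ n j → Cℚ (n ℕ.+ p) (j ℕ.+ p) ≡ₚ Cℚ n (j ℕ.+ p) + Cℚ n j
    [n+p]C[j+p]≡ₚnC[j+p]+nCj zero zero =
      ≡ₚ-reflexive (trans (cong ℕtoℚ (nCn≡1 p)) (sym (ℚP.+-identityˡ 1ℚ)))
    [n+p]C[j+p]≡ₚnC[j+p]+nCj zero (suc j) =
      ≡ₚ-reflexive (trans (cong ℕtoℚ (k>n⇒nCk≡0 {p} {suc j ℕ.+ p} (s≤s (ℕP.m≤n+m p j)))) (sym (ℚP.+-identityˡ 0ℚ)))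
    [n+p]C[j+p]≡ₚnC[j+p]+nCj (suc n) zero = subst₂ _≡ₚ_ (pascalℚ (n ℕ.+ p) (suc k)) regroup
      (≡ₚ-+ ([n+p]Cj≡ₚnCj n (suc k) ℕP.≤-refl) ([n+p]C[j+p]≡ₚnC[j+p]+nCj n zero))
      where
      regroup : Cℚ n (suc k) + (Cℚ n p + Cℚ n 0) ≡ Cℚ (suc n) p + Cℚ (suc n) 0
      regroup = trans (sym (ℚP.+-assoc (Cℚ n (suc k)) (Cℚ n p) (Cℚ n 0))) (cong (_+ Cℚ n 0) (pascalℚ n (suc k)))
    [n+p]C[j+p]≡ₚnC[j+p]+nCj (suc n) (suc j) = subst₂ _≡ₚ_ (pascalℚ (n ℕ.+ p) (j ℕ.+ p)) regroup
      (≡ₚ-+ ([n+p]C[j+p]≡ₚnC[j+p]+nCj n j) ([n+p]C[j+p]≡ₚnC[j+p]+nCj n (suc j)))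
      where
      regroup : (Cℚ n (j ℕ.+ p) + Cℚ n j) + (Cℚ n (suc j ℕ.+ p) + Cℚ n (suc j)) ≡ Cℚ (suc n) (suc j ℕ.+ p) + Cℚ (suc n) (suc j)
      regroup = trans (solve 4 (λ a b c d → (a :+ b) :+ (c :+ d) := (a :+ c) :+ (b :+ d)) refl
                               (Cℚ n (j ℕ.+ p)) (Cℚ n j) (Cℚ n (suc j ℕ.+ p)) (Cℚ n (suc j)))
                      (cong₂ _+_ (pascalℚ n (j ℕ.+ p)) (pascalℚ n j))

    [1+a]p≡ap+p : ∀ a → suc a ℕ.* p ≡ a ℕ.* p ℕ.+ p
    [1+a]p≡ap+p a = ℕP.+-comm p (a ℕ.* p)

    [ap]C[bp]≡ₚaCb : ∀ a b → Cℚ (a ℕ.* p) (b ℕ.* p) ≡ₚ Cℚ a b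
    [ap]C[bp]≡ₚaCb zero    zero    = ≡ₚ-refl
    [ap]C[bp]≡ₚaCb zero    (suc b) = ≡ₚ-refl
    [ap]C[bp]≡ₚaCb (suc a) zero    = subst (λ n → Cℚ n 0 ≡ₚ 1ℚ) (sym ([1+a]p≡ap+p a)) ≡ₚ-refl
    [ap]C[bp]≡ₚaCb (suc a) (suc b) =
      subst₂ (λ n j → Cℚ n j ≡ₚ Cℚ (suc a) (suc b)) (sym ([1+a]p≡ap+p a)) (sym ([1+a]p≡ap+p b))
        (≡ₚ-trans ([n+p]C[j+p]≡ₚnC[j+p]+nCj (a ℕ.* p) (b ℕ.* p))
          (subst (Cℚ (a ℕ.* p) (b ℕ.* p ℕ.+ p) + Cℚ (a ℕ.* p) (b ℕ.* p) ≡ₚ_) (trans (ℚP.+-comm (Cℚ a (suc b)) (Cℚ a b)) (pascalℚ a b))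
            (≡ₚ-+ (subst (λ j → Cℚ (a ℕ.* p) j ≡ₚ Cℚ a (suc b)) ([1+a]p≡ap+p b) ([ap]C[bp]≡ₚaCb a (suc b)))
                  ([ap]C[bp]≡ₚaCb a b))))

    [ap]C[bp+r]≡ₚ0 : ∀ a b r → 0 < r → r < p → Cℚ (a ℕ.* p) (b ℕ.* p ℕ.+ r) ≡ₚ 0ℚ
    [ap]C[bp+r]≡ₚ0 zero b (suc r) _ _ =
      ≡ₚ-reflexive (cong ℕtoℚ (k>n⇒nCk≡0 (subst (0 <_) (sym (ℕP.+-suc (b ℕ.* p) r)) (s≤s z≤n))))
    [ap]C[bp+r]≡ₚ0 (suc a) zero r 0<r r<p = subst (λ n → Cℚ n r ≡ₚ 0ℚ) (sym ([1+a]p≡ap+p a))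
      (≡ₚ-trans ([n+p]Cj≡ₚnCj (a ℕ.* p) r r<p) ([ap]C[bp+r]≡ₚ0 a zero r 0<r r<p))
    [ap]C[bp+r]≡ₚ0 (suc a) (suc b) r 0<r r<p = subst₂ (λ n j → Cℚ n j ≡ₚ 0ℚ) (sym ([1+a]p≡ap+p a)) bp+r+p≡[1+b]p+r
      (≡ₚ-trans ([n+p]C[j+p]≡ₚnC[j+p]+nCj (a ℕ.* p) (b ℕ.* p ℕ.+ r))
        (subst (Cℚ (a ℕ.* p) (b ℕ.* p ℕ.+ r ℕ.+ p) + Cℚ (a ℕ.* p) (b ℕ.* p ℕ.+ r) ≡ₚ_) (ℚP.+-identityˡ 0ℚ)
          (≡ₚ-+ (subst (λ j → Cℚ (a ℕ.* p) j ≡ₚ 0ℚ) (sym bp+r+p≡[1+b]p+r) ([ap]C[bp+r]≡ₚ0 a (suc b) r 0<r r<p))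
                ([ap]C[bp+r]≡ₚ0 a b r 0<r r<p))))
      where
      bp+r+p≡[1+b]p+r : b ℕ.* p ℕ.+ r ℕ.+ p ≡ suc b ℕ.* p ℕ.+ r
      bp+r+p≡[1+b]p+r = trans (ℕP.+-assoc (b ℕ.* p) r p) (trans (cong (b ℕ.* p ℕ.+_) (ℕP.+-comm r p))
                          (trans (sym (ℕP.+-assoc (b ℕ.* p) p r)) (cong (ℕ._+ r) (sym ([1+a]p≡ap+p b)))))

    [ap]Cj≡ₚ0 : ∀ a j → ¬ (p ∣ j) → Cℚ (a ℕ.* p) j ≡ₚ 0ℚ
    [ap]Cj≡ₚ0 a j p∤j with j % p in j%p
    ... | zero  = ⊥-elim (p∤j (m%n≡0⇒n∣m j p j%p))
    ... | suc r = subst (λ i → Cℚ (a ℕ.* p) i ≡ₚ 0ℚ) (sym j≡[j/p]p+r)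
                    ([ap]C[bp+r]≡ₚ0 a (j div p) (suc r) (s≤s z≤n) (subst (_< p) j%p (m%n<n j p)))
      where
      j≡[j/p]p+r : j ≡ (j div p) ℕ.* p ℕ.+ suc r
      j≡[j/p]p+r = trans (m≡m%n+[m/n]*n j p) (trans (cong (ℕ._+ (j div p) ℕ.* p) j%p) (ℕP.+-comm (suc r) _))

    [a+1]^p≡ₚ1+a^p : ∀ a → Integral a → powℚ (a + 1ℚ) p ≡ₚ 1ℚ + powℚ a p
    [a+1]^p≡ₚ1+a^p a ia = subst (_≡ₚ 1ℚ + powℚ a p) (sym (trans (binomial-theorem a p) (sumTo-suc-head (suc k) _)))
      (≡ₚ-+ (≡ₚ-reflexive (ℚP.*-identityˡ 1ℚ))
        (subst (sumTo (suc k) inner ≡ₚ_) last-term (sumTo-≡ₚ-last k inner (λ j j≤k →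
          ≡ₚ0-*ʳ (integral-pow (suc j) ia) (p∣⇒≡ₚ0 (p∣pCj (suc j) (s≤s z≤n) (s≤s (s≤s j≤k))))))))
      where
      inner : ℕ → ℚ
      inner j = Cℚ p (suc j) * powℚ a (suc j)
      last-term : inner (suc k) ≡ powℚ a p
      last-term = trans (cong (λ z → ℕtoℚ z * powℚ a p) (nCn≡1 p)) (ℚP.*-identityˡ _)

    fermat-ℕ : ∀ m → powℚ (ℕtoℚ m) p ≡ₚ ℕtoℚ m
    fermat-ℕ zero    = ≡ₚ-reflexive (ℚP.*-zeroˡ (powℚ 0ℚ (suc k)))
    fermat-ℕ (suc m) = subst₂ _≡ₚ_ (cong (λ z → powℚ z p) (sym 1+m≡m+1)) (trans (ℚP.+-comm 1ℚ (ℕtoℚ m)) (sym 1+m≡m+1))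
      (≡ₚ-trans ([a+1]^p≡ₚ1+a^p (ℕtoℚ m) (integral-ℕ m)) (≡ₚ-+ (≡ₚ-refl {1ℚ}) (fermat-ℕ m)))
      where
      1+m≡m+1 : ℕtoℚ (suc m) ≡ ℕtoℚ m + 1ℚ
      1+m≡m+1 = trans (cong ℕtoℚ (ℕP.+-comm 1 m)) (ℕtoℚ-+ m 1)

    -- Multiply (i!)^p ≡ i! by (1/i!)^p · (1/i!).
    fermat-invFact : ∀ i → i < p → powℚ (invFact i) p ≡ₚ invFact i
    fermat-invFact i i<p = ≡ₚ-sym (subst₂ _≡ₚ_ cancel-left cancel-right (≡ₚ-*ˡ (integral-* (integral-pow p iu) iu) (fermat-ℕ (i !))))
      where
      u : ℚ
      u = invFact i
      w : ℚ
      w = ℕtoℚ (i !)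
      iu : Integral u
      iu = integral-invFact i i<p
      open ≡-Reasoning
      cancel-left : (powℚ u p * u) * powℚ w p ≡ u
      cancel-left = begin
        (powℚ u p * u) * powℚ w p  ≡⟨ solve 3 (λ a b c → (a :* b) :* c := b :* (c :* a)) refl (powℚ u p) u (powℚ w p) ⟩
        u * (powℚ w p * powℚ u p)  ≡⟨ cong (u *_) (sym (powℚ-distrib-* w u p)) ⟩
        u * powℚ (w * u) p         ≡⟨ cong (λ z → u * powℚ z p) (n!*invFact≡1 i) ⟩
        u * powℚ 1ℚ p              ≡⟨ cong (u *_) (powℚ-1ℚ p) ⟩
        u * 1ℚ                     ≡⟨ ℚP.*-identityʳ u ⟩
        u                          ∎
      cancel-right : (powℚ u p * u) * w ≡ powℚ u p
      cancel-right = begin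
        (powℚ u p * u) * w  ≡⟨ ℚP.*-assoc (powℚ u p) u w ⟩
        powℚ u p * (u * w)  ≡⟨ cong (powℚ u p *_) (trans (ℚP.*-comm u w) (n!*invFact≡1 i)) ⟩
        powℚ u p * 1ℚ       ≡⟨ ℚP.*-identityʳ _ ⟩
        powℚ u p            ∎

    sumTo-sparse : ∀ K F → (∀ j → ¬ (p ∣ j) → F j ≡ₚ 0ℚ) → sumTo (K ℕ.* p) F ≡ₚ sumTo K (λ d → F (d ℕ.* p))
    sumTo-sparse zero    F h = ≡ₚ-refl
    sumTo-sparse (suc K) F h = subst (_≡ₚ sumTo (suc K) (λ d → F (d ℕ.* p))) (sym (sumTo-split (suc k) (K ℕ.* p) F))
      (≡ₚ-+ (sumTo-sparse K F h) (sumTo-≡ₚ-last k (λ i → F (suc i ℕ.+ K ℕ.* p)) (λ i i≤k → h _ (p∤[1+i]+Kp i i≤k))))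
      where
      p∤[1+i]+Kp : ∀ i → i ≤ k → ¬ (p ∣ suc i ℕ.+ K ℕ.* p)
      p∤[1+i]+Kp i i≤k p∣ = 0<m<p⇒p∤m (s≤s z≤n) (s≤s (s≤s i≤k))
        (∣.∣m+n∣m⇒∣n (subst (p ∣_) (ℕP.+-comm (suc i) (K ℕ.* p)) p∣) (∣.n∣m*n K))

    ap≤ᵇbp≡a≤ᵇb : ∀ a b → (a ℕ.* p ≤ᵇ b ℕ.* p) ≡ (a ≤ᵇ b)
    ap≤ᵇbp≡a≤ᵇb a b with a ≤ᵇ b in a≤b | a ℕ.* p ≤ᵇ b ℕ.* p in ap≤bp
    ... | true  | true  = refl
    ... | false | false = refl
    ... | true  | false = ⊥-elim (≡false⇒¬T ap≤bp (ℕP.≤⇒≤ᵇ (ℕP.*-monoˡ-≤ p (ℕP.≤ᵇ⇒≤ a b (≡true⇒T a≤b)))))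
    ... | false | true  = ⊥-elim (≡false⇒¬T a≤b (ℕP.≤⇒≤ᵇ (ℕP.*-cancelʳ-≤ a b p (ℕP.≤ᵇ⇒≤ (a ℕ.* p) (b ℕ.* p) (≡true⇒T ap≤bp)))))

    a*p^[1+e]≡a*p^e*p : ∀ a e → a ℕ.* p ^ suc e ≡ a ℕ.* p ^ e ℕ.* p
    a*p^[1+e]≡a*p^e*p a e = trans (cong (a ℕ.*_) (ℕP.*-comm p (p ^ e))) (sym (ℕP.*-assoc a (p ^ e) p))

    module Frobenius (x : ℕ → ℚ)
                     (weight-integral : ∀ t → Integral (weight x t))
                     (weight-fermat : ∀ t → powℚ (weight x t) p ≡ₚ weight x t) where

      coeff-integral : ∀ t m K N → Integral (coeff x t m K N)
      coeff-integral t zero K N with (K ≡ᵇ 0) ∧ (N ≡ᵇ 0)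
      ... | true  = integral-* (integral-ℕ (K !)) (integral-ℕ 1)
      ... | false = integral-* (integral-ℕ (K !)) (integral-ℕ 0)
      coeff-integral t (suc m) K N = subst Integral (sym (coeff-expand x t m K N)) (integral-sumTo K _ λ j _ →
        if-elim Integral (t ℕ.* j ≤ᵇ N)
          (λ _ → integral-* (integral-* (integral-ℕ (K C j)) (integral-pow j (weight-integral t))) (coeff-integral (suc t) m (K ∸ j) (N ∸ t ℕ.* j)))
          (λ _ → integral-ℕ 0))

      coeff-term-p∤≡ₚ0 : ∀ t m K N j → ¬ (p ∣ j) → coeff-term x t m (K ℕ.* p) N j ≡ₚ 0ℚ
      coeff-term-p∤≡ₚ0 t m K N j p∤j = if-elim (_≡ₚ 0ℚ) (t ℕ.* j ≤ᵇ N)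
        (λ _ → ≡ₚ0-*ʳ (coeff-integral (suc t) m (K ℕ.* p ∸ j) (N ∸ t ℕ.* j))
                 (≡ₚ0-*ʳ (integral-pow j (weight-integral t)) ([ap]Cj≡ₚ0 K j p∤j)))
        (λ _ → ≡ₚ-refl)

      coeff-*p : ∀ m t K N → coeff x t m (K ℕ.* p) (N ℕ.* p) ≡ₚ coeff x t m K N
      coeff-*p zero    t zero    zero    = ≡ₚ-refl
      coeff-*p zero    t zero    (suc N) = ≡ₚ-refl
      coeff-*p zero    t (suc K) N       =
        ≡ₚ-reflexive (trans (ℚP.*-zeroʳ (ℕtoℚ ((suc K ℕ.* p) !))) (sym (ℚP.*-zeroʳ (ℕtoℚ (suc K !)))))
      coeff-*p (suc m) t K N = subst₂ _≡ₚ_ (sym (coeff-expand x t m (K ℕ.* p) (N ℕ.* p))) (sym (coeff-expand x t m K N))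
        (≡ₚ-trans (sumTo-sparse K _ (coeff-term-p∤≡ₚ0 t m K (N ℕ.* p))) (≡ₚ-sumTo K (λ d _ → term-*p d)))
        where
        w : ℚ
        w = weight x t
        term-*p : ∀ d → coeff-term x t m (K ℕ.* p) (N ℕ.* p) (d ℕ.* p) ≡ₚ coeff-term x t m K N d
        term-*p d = subst (λ b → (if b then scaled else 0ℚ) ≡ₚ coeff-term x t m K N d) (sym fits≡)
          (if-elim₂ _≡ₚ_ (t ℕ.* d ≤ᵇ N) (λ _ → factors) (λ _ → ≡ₚ-refl))
          where
          scaled : ℚ
          scaled = Cℚ (K ℕ.* p) (d ℕ.* p) * powℚ w (d ℕ.* p) * coeff x (suc t) m (K ℕ.* p ∸ d ℕ.* p) (N ℕ.* p ∸ t ℕ.* (d ℕ.* p))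
          fits≡ : (t ℕ.* (d ℕ.* p) ≤ᵇ N ℕ.* p) ≡ (t ℕ.* d ≤ᵇ N)
          fits≡ = trans (cong (_≤ᵇ N ℕ.* p) (sym (ℕP.*-assoc t d p))) (ap≤ᵇbp≡a≤ᵇb (t ℕ.* d) N)
          rest-*p : coeff x (suc t) m (K ℕ.* p ∸ d ℕ.* p) (N ℕ.* p ∸ t ℕ.* (d ℕ.* p)) ≡ₚ coeff x (suc t) m (K ∸ d) (N ∸ t ℕ.* d)
          rest-*p = subst₂ (λ K′ N′ → coeff x (suc t) m K′ N′ ≡ₚ coeff x (suc t) m (K ∸ d) (N ∸ t ℕ.* d))
            (ℕP.*-distribʳ-∸ p K d) (trans (ℕP.*-distribʳ-∸ p N (t ℕ.* d)) (cong (N ℕ.* p ∸_) (ℕP.*-assoc t d p)))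
            (coeff-*p m (suc t) (K ∸ d) (N ∸ t ℕ.* d))
          factors : scaled ≡ₚ Cℚ K d * powℚ w d * coeff x (suc t) m (K ∸ d) (N ∸ t ℕ.* d)
          factors = ≡ₚ-* (integral-* (integral-ℕ (K ℕ.* p C d ℕ.* p)) (integral-pow (d ℕ.* p) (weight-integral t)))
                         (coeff-integral (suc t) m (K ∸ d) (N ∸ t ℕ.* d))
            (≡ₚ-* (integral-ℕ (K ℕ.* p C d ℕ.* p)) (integral-pow d (weight-integral t)) ([ap]C[bp]≡ₚaCb K d)
              (subst (_≡ₚ powℚ w d) (sym (powℚ-* w d p))
                (≡ₚ-pow d (integral-pow p (weight-integral t)) (weight-integral t) (weight-fermat t))))
            rest-*p

      coeff-vanish : ∀ m t K N → ¬ (p ∣ N) → coeff x t m (K ℕ.* p) N ≡ₚ 0ℚ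
      coeff-vanish zero    t K       zero    p∤N = ⊥-elim (p∤N (p ∣.∣0))
      coeff-vanish zero    t zero    (suc N) _   = ≡ₚ-reflexive (ℚP.*-zeroʳ (ℕtoℚ 1))
      coeff-vanish zero    t (suc K) (suc N) _   = ≡ₚ-reflexive (ℚP.*-zeroʳ (ℕtoℚ ((suc K ℕ.* p) !)))
      coeff-vanish (suc m) t K N p∤N = subst (_≡ₚ 0ℚ) (sym (coeff-expand x t m (K ℕ.* p) N)) (sumTo-≡ₚ0 (K ℕ.* p) (λ j _ → term≡ₚ0 j))
        where
        term≡ₚ0 : ∀ j → coeff-term x t m (K ℕ.* p) N j ≡ₚ 0ℚ
        term≡ₚ0 j with p ∣.∣? j
        ... | no p∤j = coeff-term-p∤≡ₚ0 t m K N j p∤j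
        term≡ₚ0 .(d ℕ.* p) | yes (divides d refl) = if-elim (_≡ₚ 0ℚ) (t ℕ.* (d ℕ.* p) ≤ᵇ N)
          (λ fits → ≡ₚ0-*ˡ (integral-* (integral-ℕ (K ℕ.* p C d ℕ.* p)) (integral-pow (d ℕ.* p) (weight-integral t)))
            (subst (λ K′ → coeff x (suc t) m K′ (N ∸ t ℕ.* (d ℕ.* p)) ≡ₚ 0ℚ) (ℕP.*-distribʳ-∸ p K d)
              (coeff-vanish m (suc t) (K ∸ d) (N ∸ t ℕ.* (d ℕ.* p)) (p∤rest fits))))
          (λ _ → ≡ₚ-refl)
          where
          p∤rest : (t ℕ.* (d ℕ.* p) ≤ᵇ N) ≡ true → ¬ (p ∣ N ∸ t ℕ.* (d ℕ.* p))
          p∤rest fits p∣ = p∤N (∣.∣m∸n∣n⇒∣m p (ℕP.≤ᵇ⇒≤ _ N (≡true⇒T fits)) p∣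
                                 (subst (p ∣_) (ℕP.*-assoc t d p) (∣.n∣m*n (t ℕ.* d))))

      coeff-*p^ : ∀ t m e K N → coeff x t m (K ℕ.* p ^ e) (N ℕ.* p ^ e) ≡ₚ coeff x t m K N
      coeff-*p^ t m zero K N =
        subst₂ (λ K′ N′ → coeff x t m K′ N′ ≡ₚ coeff x t m K N) (sym (ℕP.*-identityʳ K)) (sym (ℕP.*-identityʳ N)) ≡ₚ-refl
      coeff-*p^ t m (suc e) K N =
        subst₂ (λ K′ N′ → coeff x t m K′ N′ ≡ₚ coeff x t m K N) (sym (a*p^[1+e]≡a*p^e*p K e)) (sym (a*p^[1+e]≡a*p^e*p N e))
          (≡ₚ-trans (coeff-*p m t (K ℕ.* p ^ e) (N ℕ.* p ^ e)) (coeff-*p^ t m e K N))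

      coeff-vanish^ : ∀ t m e K N → ¬ (p ^ e ∣ N) → coeff x t m (K ℕ.* p ^ e) N ≡ₚ 0ℚ
      coeff-vanish^ t m zero K N p^e∤N = ⊥-elim (p^e∤N (∣.1∣ N))
      coeff-vanish^ t m (suc e) K N p^e∤N with p ∣.∣? N
      ... | no p∤N = subst (λ K′ → coeff x t m K′ N ≡ₚ 0ℚ) (sym (a*p^[1+e]≡a*p^e*p K e)) (coeff-vanish m t (K ℕ.* p ^ e) N p∤N)
      ... | yes (divides q refl) = subst (λ K′ → coeff x t m K′ (q ℕ.* p) ≡ₚ 0ℚ) (sym (a*p^[1+e]≡a*p^e*p K e))
        (≡ₚ-trans (coeff-*p m t (K ℕ.* p ^ e) q) (coeff-vanish^ t m e K q p^e∤q))
        where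
        p^e∤q : ¬ (p ^ e ∣ q)
        p^e∤q p^e∣q = p^e∤N (subst (_∣ q ℕ.* p) (ℕP.*-comm (p ^ e) p) (∣.*-pres-∣ p^e∣q (∣.∣-refl {p})))

    ones≤ : ℕ → ℚ
    ones≤ i = if i ≤ᵇ suc k then 1ℚ else 0ℚ

    ones≤-weight : ∀ i → Integral (weight ones≤ i) × powℚ (weight ones≤ i) p ≡ₚ weight ones≤ i
    ones≤-weight i with i ≤ᵇ suc k in i≤
    ... | true  = subst (λ z → Integral z × powℚ z p ≡ₚ z) (sym (ℚP.*-identityˡ (invFact i)))
                    (integral-invFact i i<p ,, fermat-invFact i i<p)
      where
      i<p : i < p
      i<p = s≤s (ℕP.≤ᵇ⇒≤ i (suc k) (≡true⇒T i≤))
    ... | false = subst (λ z → Integral z × powℚ z p ≡ₚ z) (sym (ℚP.*-zeroˡ (invFact i)))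
                    (integral-ℕ 0 ,, ≡ₚ-reflexive (ℚP.*-zeroˡ (powℚ 0ℚ (suc k))))

    open Frobenius ones≤ (λ i → proj₁ (ones≤-weight i)) (λ i → proj₂ (ones≤-weight i))

    ones≤-small : ∀ i → i ≤ suc k → 1ℚ ≡ ones≤ i
    ones≤-small i i≤ with i ≤ᵇ suc k in i≤ᵇ
    ... | true  = refl
    ... | false = ⊥-elim (≡false⇒¬T i≤ᵇ (ℕP.≤⇒≤ᵇ i≤))

    S≤≡Bell-ones≤ : ∀ N K → S≤ (suc k) N K ≡ Bell N K ones≤
    S≤≡Bell-ones≤ N K with suc (N ∸ K) ≤ᵇ suc k in narrow
    ... | true  = Bell-cong N K _ ones≤ (λ i _ i≤ → ones≤-small i (ℕP.≤-trans i≤ (ℕP.≤ᵇ⇒≤ _ (suc k) (≡true⇒T narrow))))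
    ... | false = refl

    S≡Bell-ones≤ : ∀ q s → q ∸ s ≤ k → S q s ≡ Bell q s ones≤
    S≡Bell-ones≤ q s q∸s≤k = Bell-cong q s _ ones≤ (λ i _ i≤ → ones≤-small i (ℕP.≤-trans i≤ (s≤s q∸s≤k)))

    scaled-S≤≡coeff : ∀ N K → ℕtoℚ (K !) * invFact N * S≤ (suc k) N K ≡ coeff ones≤ 1 (suc (N ∸ K)) K N
    scaled-S≤≡coeff N K = trans (cong (ℕtoℚ (K !) * invFact N *_) (S≤≡Bell-ones≤ N K)) (scaled-Bell≡coeff N K ones≤)

    restricted-Stirling-vanishes : ∀ e s N → ¬ (p ^ e ∣ N) →
      CongMod p (ℕtoℚ ((s ℕ.* p ^ e) !) * invFact N * S≤ (suc k) N (s ℕ.* p ^ e)) 0ℚ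
    restricted-Stirling-vanishes e s N p^e∤N = toCongMod-≡ₚ
      (subst Integral (sym (scaled-S≤≡coeff N K)) (coeff-integral 1 (suc (N ∸ K)) K N)) (integral-ℕ 0)
      (subst (_≡ₚ 0ℚ) (sym (scaled-S≤≡coeff N K)) (coeff-vanish^ 1 (suc (N ∸ K)) e s N p^e∤N))
      where
      K : ℕ
      K = s ℕ.* p ^ e

    restricted-Stirling-descends : ∀ e s q → 1 ≤ s → s ≤ q → q < p →
      CongMod p (ℕtoℚ ((s ℕ.* p ^ e) !) * invFact (q ℕ.* p ^ e) * S≤ (suc k) (q ℕ.* p ^ e) (s ℕ.* p ^ e))
                (ℕtoℚ (s !) * invFact q * S q s)
    restricted-Stirling-descends e s q 1≤s s≤q q<p = toCongMod-≡ₚ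
      (subst Integral (sym lhs≡) (coeff-integral 1 M K N)) (subst Integral (sym rhs≡) (coeff-integral 1 (suc (q ∸ s)) s q))
      (subst₂ _≡ₚ_ (sym lhs≡) (sym rhs≡)
        (subst (coeff ones≤ 1 M K N ≡ₚ_) (coeff-widen ones≤ M s q s≤q width≤M) (coeff-*p^ 1 M e s q)))
      where
      K : ℕ
      K = s ℕ.* p ^ e
      N : ℕ
      N = q ℕ.* p ^ e
      M : ℕ
      M = suc (N ∸ K)
      q∸s≤k : q ∸ s ≤ k
      q∸s≤k = ℕP.≤-pred (ℕP.≤-trans (ℕP.∸-monoʳ-< {q} {s} {0} 1≤s s≤q) (ℕP.≤-pred q<p))
      width≤M : suc (q ∸ s) ≤ M
      width≤M = s≤s (subst (q ∸ s ≤_) (ℕP.*-distribʳ-∸ (p ^ e) q s) (ℕP.m≤m*n (q ∸ s) (p ^ e) {{ℕP.m^n≢0 p e}}))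
      lhs≡ : ℕtoℚ (K !) * invFact N * S≤ (suc k) N K ≡ coeff ones≤ 1 M K N
      lhs≡ = scaled-S≤≡coeff N K
      rhs≡ : ℕtoℚ (s !) * invFact q * S q s ≡ coeff ones≤ 1 (suc (q ∸ s)) s q
      rhs≡ = trans (cong (ℕtoℚ (s !) * invFact q *_) (S≡Bell-ones≤ q s q∸s≤k)) (scaled-Bell≡coeff q s ones≤)

open import Data.Nat using (ℕ; suc; _∸_; _^_; _≤_; _*_; _%_; _!; s≤s; z≤n)
import Data.Nat.Properties as ℕP
open import Data.Nat.Primality using (Prime; ¬prime[0]; ¬prime[1])
open import Data.Nat.Divisibility using (_∣_)
open import Data.Rational using (0ℚ) renaming (_*_ to _*ℚ_)
open import Data.Product using (_×_; _,_)
open import Data.Empty using (⊥-elim)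
open import Relation.Nullary using (¬_)
open import Relation.Binary.PropositionalEquality using (_≡_; refl)
open BellCoefficients using (module ModPrime)

lemma3p14 : (p : ℕ) → Prime p → p % 2 ≡ 1 →
            (n : ℕ) → 2 ≤ n →
            (s : ℕ) → 1 ≤ s → s ≤ p ∸ 1 →
            (t : ℕ) → s * p ^ (n ∸ 2) ≤ t → t ≤ p ^ (n ∸ 1) ∸ 1 →
            (¬ (p ^ (n ∸ 2) ∣ t) →
               CongMod p (ℕtoℚ ((s * p ^ (n ∸ 2)) !) *ℚ invFact t *ℚ S≤ (p ∸ 1) t (s * p ^ (n ∸ 2))) 0ℚ)
            ×
            ((q : ℕ) → t ≡ q * p ^ (n ∸ 2) →
               CongMod p (ℕtoℚ ((s * p ^ (n ∸ 2)) !) *ℚ invFact t *ℚ S≤ (p ∸ 1) t (s * p ^ (n ∸ 2)))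
                         (ℕtoℚ (s !) *ℚ invFact q *ℚ S q s))
lemma3p14 0 p-prime = ⊥-elim (¬prime[0] p-prime)
lemma3p14 1 p-prime = ⊥-elim (¬prime[1] p-prime)
lemma3p14 (suc (suc k)) p-prime _ 0 ()
lemma3p14 (suc (suc k)) p-prime _ 1 (s≤s ())
lemma3p14 p@(suc (suc k)) p-prime _ (suc (suc e)) _ s 1≤s _ t sp^e≤t t<p^[e+1] =
  restricted-Stirling-vanishes e s t , descends
  where
  open ModPrime k p-prime using (restricted-Stirling-vanishes; restricted-Stirling-descends)
  descends : (q : ℕ) → t ≡ q * p ^ e →
             CongMod p (ℕtoℚ ((s * p ^ e) !) *ℚ invFact t *ℚ S≤ (suc k) t (s * p ^ e)) (ℕtoℚ (s !) *ℚ invFact q *ℚ S q s)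
  descends q refl = restricted-Stirling-descends e s q 1≤s (ℕP.*-cancelʳ-≤ s q (p ^ e) {{ℕP.m^n≢0 p e}} sp^e≤t)
    (ℕP.*-cancelʳ-< (p ^ e) q p (ℕP.≤-<-trans t<p^[e+1] (ℕP.∸-monoʳ-< {n = 1} (s≤s z≤n) (ℕP.m^n>0 p (suc e)))))
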